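{- Let $F$ be a pseudo-Boolean formula, let $C: \sum_i a_i \ell_i \ge A$ be a pseudo-Boolean constraint in normalized form, and let $y$ be a variable that appears neither in $F$ nor in $C$. Consider the two constraints $$C_1:\ A\bar y + \sum_i a_i \ell_i \ge A, \qquad C_2:\ \Bigl(-A+1+\sum_i a_i\Bigr) y + \sum_i a_i \bar\ell_i \ge -A+1+\sum_i a_i,$$ which together encode $y \Leftrightarrow C$. Then both $C_1$ and $C_2$ can be derived and added to $F$ by the redundance-based strengthening rule, with the substitution redundancy conditions verified by the procedure RedundancyCheck: that is, the two constraints can be added one after the other, each one being added to the current formula $G$ (which is $F$ for the first one and $F$ conjoined with the first one for the second) together with a witness substitution $\omega$ for which RedundancyCheck$(G, \cdot, \omega)$ returns ACCEPT.
   Context: Variables are Boolean ($0$/$1$). A literal is $x$ or $\bar x = 1-x$. A pseudo-Boolean (PB) constraint $\sum_i a_i\ell_i \ge A$ is always identified with its normalized form (literals over distinct variables, non-negative integer coefficients and degree $A$; rewriting uses $\bar x = 1-x$). Its negation $\neg C$ is the normalized form of $\sum_i -a_i\ell_i \ge -A+1$. A PB formula is a conjunction of PB constraints. A substitution $\omega$ is a partial map from variables to literals or $\{0,1\}$ (with $\omega(x)=x$ outside its domain and $\omega(\bar x)=1-\omega(x)$); $C\restriction_\omega$ is $\sum_i a_i\omega(\ell_i)\ge A$ re-normalized, applied constraint-wise to formulas. A constraint $C$ is redundant w.r.t. $F$ if $F$ and $F\land C$ are equisatisfiable; the redundance-based strengthening rule allows adding to $F$ a constraint $C$ together with a witness $\omega$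 such that $F\land\neg C \models (F\land C)\restriction_\omega$, where the implication must be certified, e.g. by the procedure RedundancyCheck below. Unit propagation: under a partial assignment $\rho$, a constraint $D$ propagates literal $\ell$ if $D\restriction_\rho$ cannot be satisfied unless $\ell$ is set to $1$. Unit propagation on a formula $G$ repeatedly extends $\rho$ by propagated literals until no constraint propagates, or until some constraint is violated (cannot be satisfied) under the current assignment, called a conflict. $G$ implies $D$ by reverse unit propagation (RUP), written $G \vdash_{\mathrm{RUP}} D$, if unit propagation on $G \land \neg D$ starting from the empty assignment reaches a conflict. A constraint $D'$ is implied syntactically by $D$ if $D'$ can be obtained from $D$ by adding literal axioms $\ell \ge 0$ (followed by normalization, e.g. cancelling $y+\bar y = 1$). RedundancyCheck$(G, D, \omega)$: if $G\vdash_{\mathrm{RUP}} D$, return ACCEPT. Otherwise, for every constraint $E$ of $(G\land D)\restriction_\omega$: if none of the following holds — (a) $E\in G$, (b) $\neg D$ implies $E$ syntactically, (c) $G\land \neg D \vdash_{\mathrm{RUP}} E$ — return REJECT. If no constraint caused a rejection, return ACCEPT. -}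

module Defs where

open import Data.Nat as ℕ using (ℕ; suc; _≡ᵇ_; _<ᵇ_)
open import Data.Integer as ℤ using (ℤ; +_; -[1+_]; -_; _+_; _-_; _<_)
open import Data.Bool using (Bool; true; false; if_then_else_; not)
open import Data.List using (List; []; _∷_; map; _++_)
open import Data.Bool.ListAction using (any)
open import Data.Product using (_×_; _,_; proj₁; proj₂; Σ; ∃)
open import Data.Sum using (_⊎_)
open import Data.List.Membership.Propositional using (_∈_)
open import Data.List.Relation.Unary.All using (All)
open import Data.List.Relation.Unary.Any using (Any)
open import Relation.Binary.PropositionalEquality using (_≡_; _≢_)

data Lit : Set where
  pos : ℕ → Lit
  neg : ℕ → Lit   -- x̄ = 1 - x

var : Lit → ℕ
var (pos x) = x
var (neg x) = x

negLit : Lit → Lit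
negLit (pos x) = neg x
negLit (neg x) = pos x

_==ᴸ_ : Lit → Lit → Bool
pos x ==ᴸ pos y = x ≡ᵇ y
neg x ==ᴸ neg y = x ≡ᵇ y
_ ==ᴸ _ = false

-- PB constraints  Σ aᵢ ℓᵢ ≥ A  (raw: arbitrary integer coefficients)

record PB : Set where
  constructor pb
  field
    terms : List (ℤ × Lit)
    deg   : ℤ
open PB public

PBFormula : Set
PBFormula = List PB

-- A raw left-hand side is first rewritten (using x̄ = 1 - x) into
--   constant + Σ_x c_x · x
-- with the variables sorted increasingly and merged; then every
-- c_x > 0 gives the term c_x·x, every c_x < 0 gives |c_x|·x̄ (moving c_x
-- into the constant), c_x = 0 is dropped, and the constant is moved to
-- the degree.  The result has distinct variables (sorted) and positive
-- coefficients: this is the canonical normalized form.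

LinForm : Set
LinForm = List (ℕ × ℤ)

insertLin : ℕ → ℤ → LinForm → LinForm
insertLin x c [] = (x , c) ∷ []
insertLin x c ((y , d) ∷ r) =
  if x <ᵇ y then (x , c) ∷ (y , d) ∷ r
  else (if x ≡ᵇ y then (y , c + d) ∷ r
        else (y , d) ∷ insertLin x c r)

linearise : List (ℤ × Lit) → ℤ × LinForm
linearise [] = (+ 0 , [])
linearise ((a , pos x) ∷ ts) =
  (proj₁ (linearise ts) , insertLin x a (proj₂ (linearise ts)))
linearise ((a , neg x) ∷ ts) =
  (a + proj₁ (linearise ts) , insertLin x (- a) (proj₂ (linearise ts)))

fromLin : LinForm → ℤ × List (ℤ × Lit)
fromLin [] = (+ 0 , [])
fromLin ((x , + 0) ∷ r) = fromLin r
fromLin ((x , + suc n) ∷ r) =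
  (proj₁ (fromLin r) , (+ suc n , pos x) ∷ proj₂ (fromLin r))
fromLin ((x , -[1+ n ]) ∷ r) =
  (-[1+ n ] + proj₁ (fromLin r) , (+ suc n , neg x) ∷ proj₂ (fromLin r))

normalize : PB → PB
normalize (pb ts A) =
  pb (proj₂ (fromLin (proj₂ (linearise ts))))
     (A - proj₁ (linearise ts) - proj₁ (fromLin (proj₂ (linearise ts))))

IsNormalized : PB → Set
IsNormalized C = normalize C ≡ C

negPB : PB → PB
negPB C = normalize (pb (map (λ t → (- proj₁ t , proj₂ t)) (terms C))
                        (- deg C + + 1))

OccursIn : ℕ → PB → Set
OccursIn y C = Any (λ t → var (proj₂ t) ≡ y) (terms C)

-- Substitutions: partial maps from variables to literals or constants,
-- given as association lists (first binding wins; identity elsewhere).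

data Val : Set where
  lit   : Lit → Val
  const : Bool → Val

Subst : Set
Subst = List (ℕ × Val)

lookupω : Subst → ℕ → Val
lookupω [] x = lit (pos x)
lookupω ((z , v) ∷ ω) x = if z ≡ᵇ x then v else lookupω ω x

negVal : Val → Val
negVal (lit l) = lit (negLit l)
negVal (const b) = const (not b)

applyLit : Subst → Lit → Val
applyLit ω (pos x) = lookupω ω x
applyLit ω (neg x) = negVal (lookupω ω x)

substTerms : Subst → List (ℤ × Lit) → ℤ × List (ℤ × Lit)
substTerms ω [] = (+ 0 , [])
substTerms ω ((a , l) ∷ ts) with applyLit ω l
... | lit m       = (proj₁ (substTerms ω ts) , (a , m) ∷ proj₂ (substTerms ω ts))
... | const true  = (a + proj₁ (substTerms ω ts) , proj₂ (substTerms ω ts))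
... | const false = (proj₁ (substTerms ω ts) , proj₂ (substTerms ω ts))

restrict : Subst → PB → PB
restrict ω (pb ts A) =
  normalize (pb (proj₂ (substTerms ω ts)) (A - proj₁ (substTerms ω ts)))

-- Unit propagation.  A partial assignment is the list of literals set
-- to 1 (consistent assignments are maintained by `Unassigned`).

Assignment : Set
Assignment = List Lit

falsified : Assignment → Lit → Bool
falsified ρ ℓ = any (λ m → m ==ᴸ negLit ℓ) ρ

-- maximal value of the left-hand side of a normalized constraint
-- over all extensions of ρ
maxLHS : Assignment → List (ℤ × Lit) → ℤ
maxLHS ρ [] = + 0
maxLHS ρ ((a , l) ∷ ts) =
  if falsified ρ l then maxLHS ρ ts else a + maxLHS ρ ts

Violated : Assignment → PB → Set
Violated ρ D = maxLHS ρ (terms D) < deg D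

Propagates : Assignment → PB → Lit → Set
Propagates ρ D ℓ = Violated (negLit ℓ ∷ ρ) D

Unassigned : Assignment → Lit → Set
Unassigned ρ ℓ = All (λ m → var m ≢ var ℓ) ρ

data UPConflict (G : PBFormula) : Assignment → Set where
  conflict  : ∀ {ρ D} → D ∈ G → Violated ρ D → UPConflict G ρ
  propagate : ∀ {ρ D ℓ} → D ∈ G → Unassigned ρ ℓ → Propagates ρ D ℓ →
              UPConflict G (ℓ ∷ ρ) → UPConflict G ρ

RUP : PBFormula → PB → Set
RUP G D = UPConflict (negPB D ∷ G) []

SyntacticallyImplies : PB → PB → Set
SyntacticallyImplies D D' =
  ∃ λ (ls : List Lit) →
    normalize (pb (terms D ++ map (λ l → (+ 1 , l)) ls) (deg D)) ≡ D'

-- RedundancyCheck(G, D, ω) returns ACCEPT.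
-- (G ∧ D is represented as the list D ∷ G, G ∧ ¬D as negPB D ∷ G.)

RedundancyCheckAccepts : PBFormula → PB → Subst → Set
RedundancyCheckAccepts G D ω =
  RUP G D ⊎
  All (λ E → E ∈ G ⊎ SyntacticallyImplies (negPB D) E ⊎ RUP (negPB D ∷ G) E)
      (map (restrict ω) (D ∷ G))

sumCoeffs : List (ℤ × Lit) → ℤ
sumCoeffs [] = + 0
sumCoeffs ((a , _) ∷ ts) = a + sumCoeffs ts

C₁ : ℕ → PB → PB
C₁ y C = normalize (pb ((deg C , neg y) ∷ terms C) (deg C))

C₂ : ℕ → PB → PB
C₂ y C = normalize (pb ((B , pos y) ∷ map (λ t → (proj₁ t , negLit (proj₂ t))) (terms C)) B)
  where
  B : ℤ
  B = - deg C + + 1 + sumCoeffs (terms C)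

{-# OPTIONS --safe #-}
-- The witnesses are y ↦ 0 for C₁ and y ↦ 1 for C₂.  Under them C₁ and C₂
-- become Σ aᵢℓᵢ ≥ 0 and Σ aᵢℓ̄ᵢ ≥ 0, whose negations are violated outright,
-- so RUP succeeds; the constraints of F do not mention y and are unchanged.
-- The one real obligation is C₁↾(y ↦ 1) = C.  With B = -A + 1 + Σ aᵢ,
-- ¬C₂ normalizes to Σ aᵢℓᵢ + B ȳ ≥ A + B; if B ≥ 0, adding B copies of
-- y ≥ 0 turns it into C, and if B < 0 then C₂ is itself trivial, so ¬C₂ is
-- violated at once.
-- Normalized constraints are compared through the linear inequality they
-- denote: normalization is canonical, so two constraints denoting the same
-- inequality have equal normal forms.
module Submission where

open import Defs
open import Data.Bool using (Bool; true; false; if_then_else_; not)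
open import Data.Nat as ℕ using (ℕ; zero; suc; _≡ᵇ_; _<ᵇ_)
import Data.Nat.Properties as ℕP
open import Data.Integer as ℤ using (ℤ; +_; -[1+_]; -_; _+_; _-_; _≤_; _<_; _⊔_; +≤+; +<+)
import Data.Integer.Properties as ℤP
open import Data.Integer.Tactic.RingSolver using (solve-∀)
open import Algebra.Properties.CommutativeSemigroup ℤP.+-commutativeSemigroup using (x∙yz≈y∙xz)
open import Algebra.Properties.AbelianGroup ℤP.+-0-abelianGroup using (∙-cancelˡ)
open import Data.Product using (_×_; _,_; proj₁; proj₂; Σ)
open import Data.List using (List; []; _∷_; map; _++_; replicate; filter)
open import Data.List.Relation.Unary.All as All using (All; []; _∷_)
open import Data.List.Relation.Unary.All.Properties using (¬Any⇒All¬; all-filter; map⁺)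
open import Data.List.Relation.Unary.AllPairs using (AllPairs; []; _∷_)
import Data.List.Relation.Unary.AllPairs.Properties as AllPairs
open import Data.Empty using (⊥-elim)
open import Data.Sum using (_⊎_; inj₁; inj₂)
open import Data.List.Membership.Propositional using (_∈_)
open import Data.List.Relation.Binary.Subset.Propositional using (_⊆_)
open import Data.List.Relation.Unary.Any using (here; there)
open import Function using (_on_; id)
open import Relation.Binary.Definitions using (tri<; tri≈; tri>)
open import Relation.Binary.PropositionalEquality
open import Relation.Nullary using (¬_; ¬?; Dec; yes; no)
open import Relation.Nullary.Reflects using (Reflects; ofʸ; ofⁿ; fromEquivalence)

≡ᵇ-reflects-≡ : ∀ x z → Reflects (x ≡ z) (x ≡ᵇ z)
≡ᵇ-reflects-≡ x z = fromEquivalence (ℕP.≡ᵇ⇒≡ x z) (ℕP.≡⇒≡ᵇ x z)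

monomial : ℕ → ℤ → ℕ → ℤ
monomial x c z = if x ≡ᵇ z then c else + 0

monomial-≡ : ∀ x c → monomial x c x ≡ c
monomial-≡ x c with x ≡ᵇ x | ≡ᵇ-reflects-≡ x x
... | true  | _      = refl
... | false | ofⁿ x≢x = ⊥-elim (x≢x refl)

monomial-≢ : ∀ {x z} c → x ≢ z → monomial x c z ≡ + 0
monomial-≢ {x} {z} c x≢z with x ≡ᵇ z | ≡ᵇ-reflects-≡ x z
... | true  | ofʸ x≡z = ⊥-elim (x≢z x≡z)
... | false | _       = refl

monomial-zero : ∀ x z → monomial x (+ 0) z ≡ + 0
monomial-zero x z with x ≡ᵇ z
... | true  = refl
... | false = refl

monomial-+ : ∀ x c d z → monomial x (c + d) z ≡ monomial x c z + monomial x d z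
monomial-+ x c d z with x ≡ᵇ z
... | true  = refl
... | false = refl

monomial-neg : ∀ x c z → monomial x (- c) z ≡ - monomial x c z
monomial-neg x c z with x ≡ᵇ z
... | true  = refl
... | false = refl

-- Linear forms

-- After rewriting x̄ = 1 - x, the constraint pb ts A denotes the linear
-- inequality Σ_z coeff ts z · z ≥ rhs (pb ts A), the constant offset ts
-- having been moved to the right-hand side.

litCoeff : ℤ × Lit → ℤ
litCoeff (a , pos _) = a
litCoeff (a , neg _) = - a

coeff : List (ℤ × Lit) → ℕ → ℤ
coeff []       z = + 0
coeff (t ∷ ts) z = monomial (var (proj₂ t)) (litCoeff t) z + coeff ts z

offset : List (ℤ × Lit) → ℤ
offset ts = proj₁ (linearise ts)

rhs : PB → ℤ
rhs C = deg C - offset (terms C)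

record _≈_ (C D : PB) : Set where
  field
    coeff-≡ : ∀ z → coeff (terms C) z ≡ coeff (terms D) z
    rhs-≡   : rhs C ≡ rhs D
open _≈_

coeffᴸ : LinForm → ℕ → ℤ
coeffᴸ []            z = + 0
coeffᴸ ((x , c) ∷ L) z = monomial x c z + coeffᴸ L z

lin : List (ℤ × Lit) → LinForm
lin ts = proj₂ (linearise ts)

coeffᴸ-insertLin : ∀ x c L z → coeffᴸ (insertLin x c L) z ≡ monomial x c z + coeffᴸ L z
coeffᴸ-insertLin x c []            z = refl
coeffᴸ-insertLin x c ((y , d) ∷ L) z with x <ᵇ y
... | true = refl
... | false with x ≡ᵇ y | ≡ᵇ-reflects-≡ x y
...   | true  | ofʸ refl = begin
  monomial x (c + d) z + coeffᴸ L z                ≡⟨ cong (_+ coeffᴸ L z) (monomial-+ x c d z) ⟩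
  monomial x c z + monomial x d z + coeffᴸ L z     ≡⟨ ℤP.+-assoc (monomial x c z) _ _ ⟩
  monomial x c z + (monomial x d z + coeffᴸ L z)   ∎
  where open ≡-Reasoning
...   | false | _ = begin
  monomial y d z + coeffᴸ (insertLin x c L) z       ≡⟨ cong (_+_ (monomial y d z)) (coeffᴸ-insertLin x c L z) ⟩
  monomial y d z + (monomial x c z + coeffᴸ L z)    ≡⟨ x∙yz≈y∙xz (monomial y d z) (monomial x c z) (coeffᴸ L z) ⟩
  monomial x c z + (monomial y d z + coeffᴸ L z)    ∎
  where open ≡-Reasoning

coeffᴸ-lin : ∀ ts z → coeffᴸ (lin ts) z ≡ coeff ts z
coeffᴸ-lin []                 z = refl
coeffᴸ-lin ((a , pos x) ∷ ts) z =
  trans (coeffᴸ-insertLin x a (lin ts) z) (cong (_+_ (monomial x a z)) (coeffᴸ-lin ts z))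
coeffᴸ-lin ((a , neg x) ∷ ts) z =
  trans (coeffᴸ-insertLin x (- a) (lin ts) z) (cong (_+_ (monomial x (- a) z)) (coeffᴸ-lin ts z))

coeff-fromLin : ∀ L z → coeff (proj₂ (fromLin L)) z ≡ coeffᴸ L z
coeff-fromLin []                  z = refl
coeff-fromLin ((x , + 0) ∷ L)     z =
  trans (coeff-fromLin L z)
        (sym (trans (cong (_+ coeffᴸ L z) (monomial-zero x z)) (ℤP.+-identityˡ _)))
coeff-fromLin ((x , + suc n) ∷ L) z = cong (_+_ (monomial x (+ suc n) z)) (coeff-fromLin L z)
coeff-fromLin ((x , -[1+ n ]) ∷ L) z = cong (_+_ (monomial x -[1+ n ] z)) (coeff-fromLin L z)

offset-fromLin : ∀ L → offset (proj₂ (fromLin L)) ≡ - proj₁ (fromLin L)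
offset-fromLin []                   = refl
offset-fromLin ((x , + 0) ∷ L)      = offset-fromLin L
offset-fromLin ((x , + suc n) ∷ L)  = offset-fromLin L
offset-fromLin ((x , -[1+ n ]) ∷ L) =
  trans (cong (_+_ (+ suc n)) (offset-fromLin L)) (sym (ℤP.neg-distrib-+ -[1+ n ] (proj₁ (fromLin L))))

normalize-≈ : ∀ C → normalize C ≈ C
normalize-≈ (pb ts A) .coeff-≡ z = trans (coeff-fromLin (lin ts) z) (coeffᴸ-lin ts z)
normalize-≈ (pb ts A) .rhs-≡ = begin
  (A - k - f) - offset (proj₂ (fromLin (lin ts)))  ≡⟨ cong (_-_ (A - k - f)) (offset-fromLin (lin ts)) ⟩
  (A - k - f) - (- f)                              ≡⟨ cancel A k f ⟩
  A - k                                            ∎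
  where
  open ≡-Reasoning
  cancel : ∀ A k f → (A - k - f) - (- f) ≡ A - k
  cancel = solve-∀
  k = offset ts
  f = proj₁ (fromLin (lin ts))

-- Canonicity of normalization

Sorted : LinForm → Set
Sorted = AllPairs (ℕ._<_ on proj₁)

NonZeroCoeffs : LinForm → Set
NonZeroCoeffs = All (λ e → proj₂ e ≢ + 0)

Above : ℕ → LinForm → Set
Above x = All (λ e → x ℕ.< proj₁ e)

insertLin-above : ∀ {u} x c L → u ℕ.< x → Above u L → Above u (insertLin x c L)
insertLin-above x c []            u<x []            = u<x ∷ []
insertLin-above x c ((y , d) ∷ L) u<x (u<y ∷ u<L) with x <ᵇ y
... | true = u<x ∷ u<y ∷ u<L
... | false with x ≡ᵇ y
...   | true  = u<y ∷ u<L
...   | false = u<y ∷ insertLin-above x c L u<x u<L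

insertLin-sorted : ∀ x c L → Sorted L → Sorted (insertLin x c L)
insertLin-sorted x c []            []            = [] ∷ []
insertLin-sorted x c ((y , d) ∷ L) (y<L ∷ L-sorted) with x <ᵇ y | ℕP.<ᵇ-reflects-< x y
... | true  | ofʸ x<y = (x<y ∷ All.map (ℕP.<-trans x<y) y<L) ∷ y<L ∷ L-sorted
... | false | ofⁿ x≮y with x ≡ᵇ y | ≡ᵇ-reflects-≡ x y
...   | true  | _       = y<L ∷ L-sorted
...   | false | ofⁿ x≢y =
  insertLin-above x c L (ℕP.≤∧≢⇒< (ℕP.≮⇒≥ x≮y) (λ y≡x → x≢y (sym y≡x))) y<L
  ∷ insertLin-sorted x c L L-sorted

lin-sorted : ∀ ts → Sorted (lin ts)
lin-sorted []                 = []
lin-sorted ((a , pos x) ∷ ts) = insertLin-sorted x a (lin ts) (lin-sorted ts)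
lin-sorted ((a , neg x) ∷ ts) = insertLin-sorted x (- a) (lin ts) (lin-sorted ts)

clean : LinForm → LinForm
clean = filter (λ e → ¬? (proj₂ e ℤ.≟ + 0))

fromLin-clean : ∀ L → fromLin (clean L) ≡ fromLin L
fromLin-clean []                   = refl
fromLin-clean ((x , + 0) ∷ L)      = fromLin-clean L
fromLin-clean ((x , + suc n) ∷ L)  rewrite fromLin-clean L = refl
fromLin-clean ((x , -[1+ n ]) ∷ L) rewrite fromLin-clean L = refl

coeffᴸ-clean : ∀ L z → coeffᴸ (clean L) z ≡ coeffᴸ L z
coeffᴸ-clean []                   z = refl
coeffᴸ-clean ((x , + 0) ∷ L)      z =
  trans (coeffᴸ-clean L z) (sym (trans (cong (_+ coeffᴸ L z) (monomial-zero x z)) (ℤP.+-identityˡ _)))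
coeffᴸ-clean ((x , + suc n) ∷ L)  z = cong (_+_ (monomial x (+ suc n) z)) (coeffᴸ-clean L z)
coeffᴸ-clean ((x , -[1+ n ]) ∷ L) z = cong (_+_ (monomial x -[1+ n ] z)) (coeffᴸ-clean L z)

coeffᴸ-above : ∀ {x} L → Above x L → coeffᴸ L x ≡ + 0
coeffᴸ-above []            []          = refl
coeffᴸ-above ((y , c) ∷ L) (x<y ∷ x<L) = begin
  monomial y c _ + coeffᴸ L _  ≡⟨ cong₂ _+_ (monomial-≢ c (ℕP.>⇒≢ x<y)) (coeffᴸ-above L x<L) ⟩
  + 0                          ∎
  where open ≡-Reasoning

coeffᴸ-head : ∀ x c L → Above x L → coeffᴸ ((x , c) ∷ L) x ≡ c
coeffᴸ-head x c L x<L = begin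
  monomial x c x + coeffᴸ L x  ≡⟨ cong₂ _+_ (monomial-≡ x c) (coeffᴸ-above L x<L) ⟩
  c + + 0                      ≡⟨ ℤP.+-identityʳ c ⟩
  c                            ∎
  where open ≡-Reasoning

sorted-coeffᴸ-injective : ∀ L₁ L₂ → Sorted L₁ → Sorted L₂ → NonZeroCoeffs L₁ → NonZeroCoeffs L₂ →
                          (∀ z → coeffᴸ L₁ z ≡ coeffᴸ L₂ z) → L₁ ≡ L₂
sorted-coeffᴸ-injective [] [] _ _ _ _ _ = refl
sorted-coeffᴸ-injective [] ((x , c) ∷ L) _ (x<L ∷ _) _ (c≢0 ∷ _) eq =
  ⊥-elim (c≢0 (trans (sym (coeffᴸ-head x c L x<L)) (sym (eq x))))
sorted-coeffᴸ-injective ((x , c) ∷ L) [] (x<L ∷ _) _ (c≢0 ∷ _) _ eq =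
  ⊥-elim (c≢0 (trans (sym (coeffᴸ-head x c L x<L)) (eq x)))
sorted-coeffᴸ-injective ((x , c) ∷ L) ((x′ , c′) ∷ L′) (x<L ∷ L-sorted) (x′<L′ ∷ L′-sorted)
                        (c≢0 ∷ L≢0) (c′≢0 ∷ L′≢0) eq with ℕP.<-cmp x x′
... | tri< x<x′ _ _ = ⊥-elim (c≢0 (begin
  c                             ≡⟨ coeffᴸ-head x c L x<L ⟨
  coeffᴸ ((x , c) ∷ L) x        ≡⟨ eq x ⟩
  coeffᴸ ((x′ , c′) ∷ L′) x     ≡⟨ coeffᴸ-above _ (x<x′ ∷ All.map (ℕP.<-trans x<x′) x′<L′) ⟩
  + 0                           ∎))
  where open ≡-Reasoning
... | tri> _ _ x′<x = ⊥-elim (c′≢0 (begin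
  c′                            ≡⟨ coeffᴸ-head x′ c′ L′ x′<L′ ⟨
  coeffᴸ ((x′ , c′) ∷ L′) x′    ≡⟨ eq x′ ⟨
  coeffᴸ ((x , c) ∷ L) x′       ≡⟨ coeffᴸ-above _ (x′<x ∷ All.map (ℕP.<-trans x′<x) x<L) ⟩
  + 0                           ∎))
  where open ≡-Reasoning
... | tri≈ _ refl _ = cong₂ (λ d M → (x , d) ∷ M) c≡c′
  (sorted-coeffᴸ-injective L L′ L-sorted L′-sorted L≢0 L′≢0 tail-eq)
  where
  c≡c′ : c ≡ c′
  c≡c′ = trans (sym (coeffᴸ-head x c L x<L)) (trans (eq x) (coeffᴸ-head x c′ L′ x′<L′))
  tail-eq : ∀ z → coeffᴸ L z ≡ coeffᴸ L′ z
  tail-eq z = ∙-cancelˡ (monomial x c z) _ _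
    (trans (eq z) (cong (λ d → monomial x d z + coeffᴸ L′ z) (sym c≡c′)))

≈⇒normalize-≡ : ∀ {C D} → C ≈ D → normalize C ≡ normalize D
≈⇒normalize-≡ {pb ts₁ A₁} {pb ts₂ A₂} C≈D =
  cong₂ pb (cong proj₂ fromLin-≡) (cong₂ _-_ (C≈D .rhs-≡) (cong proj₁ fromLin-≡))
  where
  clean-coeff : ∀ ts z → coeffᴸ (clean (lin ts)) z ≡ coeff ts z
  clean-coeff ts z = trans (coeffᴸ-clean (lin ts) z) (coeffᴸ-lin ts z)
  clean-sorted : ∀ ts → Sorted (clean (lin ts))
  clean-sorted ts = AllPairs.filter⁺ _ (lin-sorted ts)
  fromLin-≡ : fromLin (lin ts₁) ≡ fromLin (lin ts₂)
  fromLin-≡ = begin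
    fromLin (lin ts₁)          ≡⟨ fromLin-clean (lin ts₁) ⟨
    fromLin (clean (lin ts₁))  ≡⟨ cong fromLin (sorted-coeffᴸ-injective _ _ (clean-sorted ts₁) (clean-sorted ts₂)
                                    (all-filter _ (lin ts₁)) (all-filter _ (lin ts₂))
                                    (λ z → trans (clean-coeff ts₁ z) (trans (C≈D .coeff-≡ z) (sym (clean-coeff ts₂ z))))) ⟩
    fromLin (clean (lin ts₂))  ≡⟨ fromLin-clean (lin ts₂) ⟩
    fromLin (lin ts₂)          ∎
    where open ≡-Reasoning

normalize-normalized : ∀ C → IsNormalized (normalize C)
normalize-normalized C = ≈⇒normalize-≡ (normalize-≈ C)

restrict-normalized : ∀ ω D → IsNormalized (restrict ω D)
restrict-normalized ω (pb ts A) = normalize-normalized (pb (proj₂ (substTerms ω ts)) (A - proj₁ (substTerms ω ts)))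

normalize-≡-normalized : ∀ C {D} → IsNormalized D → C ≈ D → normalize C ≡ D
normalize-≡-normalized C D-normal C≈D = trans (≈⇒normalize-≡ C≈D) D-normal

≈-trans : ∀ {C D E} → C ≈ D → D ≈ E → C ≈ E
≈-trans C≈D D≈E .coeff-≡ z = trans (C≈D .coeff-≡ z) (D≈E .coeff-≡ z)
≈-trans C≈D D≈E .rhs-≡     = trans (C≈D .rhs-≡) (D≈E .rhs-≡)

coeff-∷-≢ : ∀ {z} t ts → var (proj₂ t) ≢ z → coeff (t ∷ ts) z ≡ coeff ts z
coeff-∷-≢ t ts x≢z = trans (cong (_+ coeff ts _) (monomial-≢ (litCoeff t) x≢z)) (ℤP.+-identityˡ _)

coeff-fresh : ∀ {y} ts → All (λ t → var (proj₂ t) ≢ y) ts → coeff ts y ≡ + 0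
coeff-fresh []       []              = refl
coeff-fresh (t ∷ ts) (x≢y ∷ ts-fresh) = trans (coeff-∷-≢ t ts x≢y) (coeff-fresh ts ts-fresh)

coeff-++ : ∀ ts us z → coeff (ts ++ us) z ≡ coeff ts z + coeff us z
coeff-++ []       us z = sym (ℤP.+-identityˡ _)
coeff-++ (t ∷ ts) us z =
  trans (cong (_+_ m) (coeff-++ ts us z)) (sym (ℤP.+-assoc m (coeff ts z) (coeff us z)))
  where m = monomial (var (proj₂ t)) (litCoeff t) z

offset-++ : ∀ ts us → offset (ts ++ us) ≡ offset ts + offset us
offset-++ []                 us = sym (ℤP.+-identityˡ _)
offset-++ ((a , pos x) ∷ ts) us = offset-++ ts us
offset-++ ((a , neg x) ∷ ts) us = trans (cong (_+_ a) (offset-++ ts us)) (sym (ℤP.+-assoc a _ _))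

negate : ℤ × Lit → ℤ × Lit
negate (a , l) = (- a , l)

coeff-negate : ∀ ts z → coeff (map negate ts) z ≡ - coeff ts z
coeff-negate []             z = refl
coeff-negate ((a , l) ∷ ts) z = begin
  monomial (var l) (litCoeff (- a , l)) z + coeff (map negate ts) z  ≡⟨ cong₂ _+_ (head-negated l) (coeff-negate ts z) ⟩
  - monomial (var l) (litCoeff (a , l)) z + - coeff ts z             ≡⟨ ℤP.neg-distrib-+ (monomial (var l) (litCoeff (a , l)) z) (coeff ts z) ⟨
  - (monomial (var l) (litCoeff (a , l)) z + coeff ts z)             ∎
  where
  open ≡-Reasoning
  head-negated : ∀ l → monomial (var l) (litCoeff (- a , l)) z ≡ - monomial (var l) (litCoeff (a , l)) z
  head-negated (pos x) = monomial-neg x a z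
  head-negated (neg x) = monomial-neg x (- a) z

offset-negate : ∀ ts → offset (map negate ts) ≡ - offset ts
offset-negate []                 = refl
offset-negate ((a , pos x) ∷ ts) = offset-negate ts
offset-negate ((a , neg x) ∷ ts) =
  trans (cong (_+_ (- a)) (offset-negate ts)) (sym (ℤP.neg-distrib-+ a (offset ts)))

flip : ℤ × Lit → ℤ × Lit
flip (a , l) = (a , negLit l)

coeff-flip : ∀ ts z → coeff (map flip ts) z ≡ - coeff ts z
coeff-flip []             z = refl
coeff-flip ((a , l) ∷ ts) z = begin
  monomial (var (negLit l)) (litCoeff (a , negLit l)) z + coeff (map flip ts) z  ≡⟨ cong₂ _+_ (head-negated l) (coeff-flip ts z) ⟩
  - monomial (var l) (litCoeff (a , l)) z + - coeff ts z                ≡⟨ ℤP.neg-distrib-+ (monomial (var l) (litCoeff (a , l)) z) (coeff ts z) ⟨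
  - (monomial (var l) (litCoeff (a , l)) z + coeff ts z)                ∎
  where
  open ≡-Reasoning
  head-negated : ∀ l → monomial (var (negLit l)) (litCoeff (a , negLit l)) z ≡ - monomial (var l) (litCoeff (a , l)) z
  head-negated (pos x) = monomial-neg x a z
  head-negated (neg x) = trans (cong (λ c → monomial x c z) (sym (ℤP.neg-involutive a))) (monomial-neg x (- a) z)

offset-flip : ∀ ts → offset (map flip ts) ≡ sumCoeffs ts - offset ts
offset-flip []                 = refl
offset-flip ((a , pos x) ∷ ts) = trans (cong (_+_ a) (offset-flip ts)) (shift a (sumCoeffs ts) (offset ts))
  where
  shift : ∀ a s k → a + (s - k) ≡ (a + s) - k
  shift = solve-∀
offset-flip ((a , neg x) ∷ ts) = trans (offset-flip ts) (shift a (sumCoeffs ts) (offset ts))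
  where
  shift : ∀ a s k → s - k ≡ (a + s) - (a + k)
  shift = solve-∀

negRaw : PB → PB
negRaw C = pb (map negate (terms C)) (- deg C + + 1)

rhs-negRaw : ∀ C → rhs (negRaw C) ≡ - rhs C + + 1
rhs-negRaw C = begin
  (- deg C + + 1) - offset (map negate (terms C))  ≡⟨ cong (_-_ (- deg C + + 1)) (offset-negate (terms C)) ⟩
  (- deg C + + 1) - (- offset (terms C))           ≡⟨ regroup (deg C) (offset (terms C)) ⟩
  - rhs C + + 1                                    ∎
  where
  open ≡-Reasoning
  regroup : ∀ d k → (- d + + 1) - (- k) ≡ - (d - k) + + 1
  regroup = solve-∀

negRaw-cong : ∀ {C D} → C ≈ D → negRaw C ≈ negRaw D
negRaw-cong {C} {D} C≈D .coeff-≡ z = begin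
  coeff (map negate (terms C)) z  ≡⟨ coeff-negate (terms C) z ⟩
  - coeff (terms C) z             ≡⟨ cong -_ (C≈D .coeff-≡ z) ⟩
  - coeff (terms D) z             ≡⟨ coeff-negate (terms D) z ⟨
  coeff (map negate (terms D)) z  ∎
  where open ≡-Reasoning
negRaw-cong {C} {D} C≈D .rhs-≡ = begin
  rhs (negRaw C)  ≡⟨ rhs-negRaw C ⟩
  - rhs C + + 1   ≡⟨ cong (λ r → - r + + 1) (C≈D .rhs-≡) ⟩
  - rhs D + + 1   ≡⟨ rhs-negRaw D ⟨
  rhs (negRaw D)  ∎
  where open ≡-Reasoning

negPB-cong : ∀ {C D} → C ≈ D → negPB C ≡ negPB D
negPB-cong C≈D = ≈⇒normalize-≡ (negRaw-cong C≈D)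

coeff-negPB : ∀ C z → coeff (terms (negPB C)) z ≡ - coeff (terms C) z
coeff-negPB C z = trans (normalize-≈ (negRaw C) .coeff-≡ z) (coeff-negate (terms C) z)

rhs-negPB : ∀ C → rhs (negPB C) ≡ - rhs C + + 1
rhs-negPB C = trans (normalize-≈ (negRaw C) .rhs-≡) (rhs-negRaw C)

-- Trivial constraints

NonNegCoeffs : List (ℤ × Lit) → Set
NonNegCoeffs = All (λ t → + 0 ≤ proj₁ t)

NonPosCoeffs : List (ℤ × Lit) → Set
NonPosCoeffs = All (λ t → proj₁ t ≤ + 0)

fromLin-nonneg : ∀ L → NonNegCoeffs (proj₂ (fromLin L))
fromLin-nonneg []                   = []
fromLin-nonneg ((x , + 0) ∷ L)      = fromLin-nonneg L
fromLin-nonneg ((x , + suc n) ∷ L)  = +≤+ ℕ.z≤n ∷ fromLin-nonneg L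
fromLin-nonneg ((x , -[1+ n ]) ∷ L) = +≤+ ℕ.z≤n ∷ fromLin-nonneg L

normalized-nonneg : ∀ {C} → IsNormalized C → NonNegCoeffs (terms C)
normalized-nonneg {pb ts A} C-normal = subst NonNegCoeffs (cong terms C-normal) (fromLin-nonneg (lin ts))

posPart : ℤ → ℤ
posPart c = c ⊔ + 0

positivePart : LinForm → ℤ
positivePart []            = + 0
positivePart ((x , c) ∷ L) = posPart c + positivePart L

sumCoeffs-fromLin : ∀ L → sumCoeffs (proj₂ (fromLin L)) + proj₁ (fromLin L) ≡ positivePart L
sumCoeffs-fromLin []                   = refl
sumCoeffs-fromLin ((x , + 0) ∷ L)      = trans (sumCoeffs-fromLin L) (sym (ℤP.+-identityˡ _))
sumCoeffs-fromLin ((x , + suc n) ∷ L)  =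
  trans (ℤP.+-assoc (+ suc n) (sumCoeffs (proj₂ (fromLin L))) (proj₁ (fromLin L)))
        (cong (_+_ (+ suc n)) (sumCoeffs-fromLin L))
sumCoeffs-fromLin ((x , -[1+ n ]) ∷ L) =
  trans (cancel (+ suc n) (sumCoeffs (proj₂ (fromLin L))) (proj₁ (fromLin L)))
        (cong (_+_ (+ 0)) (sumCoeffs-fromLin L))
  where
  cancel : ∀ a s f → (a + s) + (- a + f) ≡ + 0 + (s + f)
  cancel = solve-∀

posPart-subadditive : ∀ c d → posPart (c + d) ≤ posPart c + posPart d
posPart-subadditive c d = ℤP.⊔-lub (ℤP.+-mono-≤ (ℤP.i≤i⊔j c (+ 0)) (ℤP.i≤i⊔j d (+ 0)))
                                    (ℤP.+-mono-≤ (ℤP.i≤j⊔i c (+ 0)) (ℤP.i≤j⊔i d (+ 0)))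

positivePart-insertLin : ∀ x c L → positivePart (insertLin x c L) ≤ positivePart L + posPart c
positivePart-insertLin x c []            = ℤP.≤-reflexive (ℤP.+-comm (posPart c) (+ 0))
positivePart-insertLin x c ((y , d) ∷ L) with x <ᵇ y
... | true = ℤP.≤-reflexive (ℤP.+-comm (posPart c) _)
... | false with x ≡ᵇ y
...   | true = begin
  posPart (c + d) + P          ≤⟨ ℤP.+-monoˡ-≤ P (posPart-subadditive c d) ⟩
  posPart c + posPart d + P    ≡⟨ rotate (posPart c) (posPart d) P ⟩
  posPart d + P + posPart c    ∎
  where
  open ℤP.≤-Reasoning
  P = positivePart L
  rotate : ∀ a b p → a + b + p ≡ b + p + a
  rotate = solve-∀
...   | false = begin
  posPart d + positivePart (insertLin x c L)  ≤⟨ ℤP.+-monoʳ-≤ (posPart d) (positivePart-insertLin x c L) ⟩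
  posPart d + (positivePart L + posPart c)    ≡⟨ ℤP.+-assoc (posPart d) _ _ ⟨
  posPart d + positivePart L + posPart c      ∎
  where open ℤP.≤-Reasoning

positivePart-lin : ∀ ts → NonPosCoeffs ts → positivePart (lin ts) + offset ts ≤ + 0
positivePart-lin []                 []           = ℤP.≤-refl
positivePart-lin ((a , pos x) ∷ ts) (a≤0 ∷ ts≤0) = begin
  positivePart (insertLin x a (lin ts)) + k  ≤⟨ ℤP.+-monoˡ-≤ k (positivePart-insertLin x a (lin ts)) ⟩
  P + posPart a + k                          ≡⟨ cong (λ p → P + p + k) (ℤP.i≤j⇒i⊔j≡j a≤0) ⟩
  P + + 0 + k                                ≡⟨ cong (_+ k) (ℤP.+-identityʳ P) ⟩
  P + k                                      ≤⟨ positivePart-lin ts ts≤0 ⟩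
  + 0                                        ∎
  where
  open ℤP.≤-Reasoning
  P = positivePart (lin ts)
  k = offset ts
positivePart-lin ((a , neg x) ∷ ts) (a≤0 ∷ ts≤0) = begin
  positivePart (insertLin x (- a) (lin ts)) + (a + k)  ≤⟨ ℤP.+-monoˡ-≤ (a + k) (positivePart-insertLin x (- a) (lin ts)) ⟩
  P + posPart (- a) + (a + k)                          ≡⟨ cong (λ p → P + p + (a + k)) (ℤP.i≥j⇒i⊔j≡i (ℤP.neg-mono-≤ a≤0)) ⟩
  P + - a + (a + k)                                    ≡⟨ cancel P a k ⟩
  P + k                                                ≤⟨ positivePart-lin ts ts≤0 ⟩
  + 0                                                  ∎
  where
  open ℤP.≤-Reasoning
  P = positivePart (lin ts)
  k = offset ts
  cancel : ∀ p a k → p + - a + (a + k) ≡ p + k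
  cancel = solve-∀

maxLHS-[] : ∀ ts → maxLHS [] ts ≡ sumCoeffs ts
maxLHS-[] []            = refl
maxLHS-[] ((a , l) ∷ ts) = cong (_+_ a) (maxLHS-[] ts)

-- For N = normalize (pb ts A): maxLHS [] (terms N) - deg N = positivePart (lin ts) + offset ts - A.
normalize-violated : ∀ ts A → NonPosCoeffs ts → + 0 < A → Violated [] (normalize (pb ts A))
normalize-violated ts A ts≤0 0<A = begin-strict
  maxLHS [] (proj₂ (fromLin (lin ts)))  ≡⟨ maxLHS-[] (proj₂ (fromLin (lin ts))) ⟩
  s                                     ≡⟨ regroup s f k ⟩
  (s + f) + k + (- k - f)               ≡⟨ cong (λ p → p + k + (- k - f)) (sumCoeffs-fromLin (lin ts)) ⟩
  positivePart (lin ts) + k + (- k - f) <⟨ ℤP.+-monoˡ-< (- k - f) (ℤP.≤-<-trans (positivePart-lin ts ts≤0) 0<A) ⟩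
  A + (- k - f)                         ≡⟨ regroup′ A k f ⟩
  A - k - f                             ∎
  where
  open ℤP.≤-Reasoning
  s = sumCoeffs (proj₂ (fromLin (lin ts)))
  f = proj₁ (fromLin (lin ts))
  k = offset ts
  regroup : ∀ s f k → s ≡ (s + f) + k + (- k - f)
  regroup = solve-∀
  regroup′ : ∀ A k f → A + (- k - f) ≡ A - k - f
  regroup′ = solve-∀

negPB-violated : ∀ {C ts A} → C ≈ pb ts A → NonNegCoeffs ts → A ≤ + 0 → Violated [] (negPB C)
negPB-violated {C} {ts} {A} C≈ ts≥0 A≤0 =
  subst (λ N → Violated [] N) (sym (negPB-cong C≈))
        (normalize-violated (map negate ts) (- A + + 1) (negate-nonpos ts≥0)
                            (ℤP.+-mono-≤-< (ℤP.neg-mono-≤ A≤0) (+<+ (ℕ.s≤s ℕ.z≤n))))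
  where
  negate-nonpos : ∀ {ts} → NonNegCoeffs ts → NonPosCoeffs (map negate ts)
  negate-nonpos []           = []
  negate-nonpos (a≥0 ∷ ts≥0) = ℤP.neg-mono-≤ a≥0 ∷ negate-nonpos ts≥0

-- Restriction by a single assignment

_↦_ : ℕ → Bool → Subst
y ↦ b = (y , const b) ∷ []

when : Bool → ℤ → ℤ
when b c = if b then c else + 0

holds : Bool → Lit → Bool
holds b (pos _) = b
holds b (neg _) = not b

substTerms-other : ∀ {y b} a l ts → y ≢ var l →
                   substTerms (y ↦ b) ((a , l) ∷ ts) ≡
                   (proj₁ (substTerms (y ↦ b) ts) , (a , l) ∷ proj₂ (substTerms (y ↦ b) ts))
substTerms-other {y} a (pos x) ts y≢x with y ≡ᵇ x | ≡ᵇ-reflects-≡ y x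
... | true  | ofʸ y≡x = ⊥-elim (y≢x y≡x)
... | false | _       = refl
substTerms-other {y} a (neg x) ts y≢x with y ≡ᵇ x | ≡ᵇ-reflects-≡ y x
... | true  | ofʸ y≡x = ⊥-elim (y≢x y≡x)
... | false | _       = refl

substTerms-var : ∀ b a l ts →
                 substTerms (var l ↦ b) ((a , l) ∷ ts) ≡
                 (when (holds b l) a + proj₁ (substTerms (var l ↦ b) ts) ,
                  proj₂ (substTerms (var l ↦ b) ts))
substTerms-var b a (pos x) ts with x ≡ᵇ x | ≡ᵇ-reflects-≡ x x
... | false | ofⁿ x≢x = ⊥-elim (x≢x refl)
... | true  | _ with b
...   | true  = refl
...   | false = cong (_, proj₂ (substTerms (x ↦ false) ts)) (sym (ℤP.+-identityˡ _))
substTerms-var b a (neg x) ts with x ≡ᵇ x | ≡ᵇ-reflects-≡ x x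
... | false | ofⁿ x≢x = ⊥-elim (x≢x refl)
... | true  | _ with b
...   | true  = cong (_, proj₂ (substTerms (x ↦ true) ts)) (sym (ℤP.+-identityˡ _))
...   | false = refl

coeff-substTerms-≢ : ∀ {y z} b ts → y ≢ z → coeff (proj₂ (substTerms (y ↦ b) ts)) z ≡ coeff ts z
coeff-substTerms-≢         b []             y≢z = refl
coeff-substTerms-≢ {y} {z} b ((a , l) ∷ ts) y≢z with y ℕP.≟ var l
... | yes refl rewrite substTerms-var b a l ts =
  trans (coeff-substTerms-≢ b ts y≢z) (sym (coeff-∷-≢ (a , l) ts y≢z))
... | no y≢x rewrite substTerms-other {b = b} a l ts y≢x =
  cong (_+_ (monomial (var l) (litCoeff (a , l)) z)) (coeff-substTerms-≢ b ts y≢z)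

coeff-substTerms-≡ : ∀ y b ts → coeff (proj₂ (substTerms (y ↦ b) ts)) y ≡ + 0
coeff-substTerms-≡ y b []             = refl
coeff-substTerms-≡ y b ((a , l) ∷ ts) with y ℕP.≟ var l
... | yes refl rewrite substTerms-var b a l ts = coeff-substTerms-≡ y b ts
... | no y≢x rewrite substTerms-other {b = b} a l ts y≢x =
  trans (coeff-∷-≢ (a , l) (proj₂ (substTerms (y ↦ b) ts)) (λ x≡y → y≢x (sym x≡y))) (coeff-substTerms-≡ y b ts)

offset-substTerms : ∀ y b ts →
  proj₁ (substTerms (y ↦ b) ts) + offset (proj₂ (substTerms (y ↦ b) ts)) ≡ offset ts + when b (coeff ts y)
offset-substTerms y b [] with b
... | true  = refl
... | false = refl
offset-substTerms y b ((a , l) ∷ ts) with y ℕP.≟ var l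
... | no y≢x rewrite substTerms-other {b = b} a l ts y≢x =
  trans (kept l) (cong (λ c → offset ((a , l) ∷ ts) + when b c) (sym (coeff-∷-≢ (a , l) ts (λ x≡y → y≢x (sym x≡y)))))
  where
  s  = proj₁ (substTerms (y ↦ b) ts)
  k′ = offset (proj₂ (substTerms (y ↦ b) ts))
  IH = offset-substTerms y b ts
  kept : ∀ l → s + offset ((a , l) ∷ proj₂ (substTerms (y ↦ b) ts)) ≡ offset ((a , l) ∷ ts) + when b (coeff ts y)
  kept (pos x) = IH
  kept (neg x) = trans (x∙yz≈y∙xz s a k′) (trans (cong (_+_ a) IH) (sym (ℤP.+-assoc a (offset ts) _)))
... | yes refl rewrite substTerms-var b a l ts | monomial-≡ (var l) (litCoeff (a , l)) =
  trans (ℤP.+-assoc (when (holds b l) a) s k′) (trans (cong (_+_ (when (holds b l) a)) IH) (dropped l b))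
  where
  s  = proj₁ (substTerms (var l ↦ b) ts)
  k′ = offset (proj₂ (substTerms (var l ↦ b) ts))
  c  = coeff ts (var l)
  IH = offset-substTerms (var l) b ts
  dropped : ∀ l′ b → when (holds b l′) a + (offset ts + when b c) ≡ offset ((a , l′) ∷ ts) + when b (litCoeff (a , l′) + c)
  dropped (pos x) true  = x∙yz≈y∙xz a (offset ts) c
  dropped (pos x) false = ℤP.+-identityˡ _
  dropped (neg x) true  = regroup a (offset ts) c
    where
    regroup : ∀ a k c → + 0 + (k + c) ≡ (a + k) + (- a + c)
    regroup = solve-∀
  dropped (neg x) false = sym (ℤP.+-assoc a (offset ts) (+ 0))

restrict-≈ : ∀ y b D {ts A} → coeff ts y ≡ + 0 → (∀ z → y ≢ z → coeff (terms D) z ≡ coeff ts z) →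
             rhs D - when b (coeff (terms D) y) ≡ A - offset ts → restrict (y ↦ b) D ≈ pb ts A
restrict-≈ y b (pb us A′) {ts} {A} ts-y coeffs-agree rhs-agree =
  ≈-trans (normalize-≈ (pb (proj₂ (substTerms (y ↦ b) us)) (A′ - s))) λ where
    .coeff-≡ z → restricted-coeff z (y ℕP.≟ z)
    .rhs-≡ → begin
      (A′ - s) - k′                             ≡⟨ sub-sub A′ s k′ ⟩
      A′ - (s + k′)                             ≡⟨ cong (_-_ A′) (offset-substTerms y b us) ⟩
      A′ - (offset us + when b (coeff us y))    ≡⟨ sub-sub A′ (offset us) _ ⟨
      rhs (pb us A′) - when b (coeff us y)      ≡⟨ rhs-agree ⟩
      A - offset ts                             ∎
  where
  open ≡-Reasoning
  s  = proj₁ (substTerms (y ↦ b) us)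
  k′ = offset (proj₂ (substTerms (y ↦ b) us))
  sub-sub : ∀ a b c → a - b - c ≡ a - (b + c)
  sub-sub = solve-∀
  restricted-coeff : ∀ z → Dec (y ≡ z) → coeff (proj₂ (substTerms (y ↦ b) us)) z ≡ coeff ts z
  restricted-coeff z (yes refl) = trans (coeff-substTerms-≡ y b us) (sym ts-y)
  restricted-coeff z (no y≢z)   = trans (coeff-substTerms-≢ b us y≢z) (coeffs-agree z y≢z)

substTerms-fresh : ∀ {y b} ts → All (λ t → var (proj₂ t) ≢ y) ts → substTerms (y ↦ b) ts ≡ (+ 0 , ts)
substTerms-fresh               []             []              = refl
substTerms-fresh {y} {b} ((a , l) ∷ ts) (x≢y ∷ ts-fresh)
  rewrite substTerms-other {y} {b} a l ts (λ y≡x → x≢y (sym y≡x)) | substTerms-fresh {y} {b} ts ts-fresh = refl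

restrict-fresh : ∀ {y b D} → IsNormalized D → ¬ OccursIn y D → restrict (y ↦ b) D ≡ D
restrict-fresh {y} {b} {pb ts A} D-normal y∉D rewrite substTerms-fresh {y} {b} ts (¬Any⇒All¬ ts y∉D) =
  trans (cong (λ d → normalize (pb ts d)) (ℤP.+-identityʳ A)) D-normal

restrict-fresh-⊆ : ∀ {y b G} F → F ⊆ G → All IsNormalized F → All (λ D → ¬ OccursIn y D) F →
                   All (_∈ G) (map (restrict (y ↦ b)) F)
restrict-fresh-⊆ []      F⊆G []                   []            = []
restrict-fresh-⊆ (D ∷ F) F⊆G (D-normal ∷ F-normal) (y∉D ∷ y∉F) =
  subst (_∈ _) (sym (restrict-fresh D-normal y∉D)) (F⊆G (here refl))
  ∷ restrict-fresh-⊆ F (λ D∈F → F⊆G (there D∈F)) F-normal y∉F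

RUP-trivial : ∀ G {E ts A} → E ≈ pb ts A → NonNegCoeffs ts → A ≤ + 0 → RUP G E
RUP-trivial G E≈ ts≥0 A≤0 = conflict (here refl) (negPB-violated E≈ ts≥0 A≤0)

coeff-copies : ∀ y n z → coeff (map (λ l → (+ 1 , l)) (replicate n (pos y))) z ≡ monomial y (+ n) z
coeff-copies y zero    z = sym (monomial-zero y z)
coeff-copies y (suc n) z =
  trans (cong (_+_ (monomial y (+ 1) z)) (coeff-copies y n z)) (sym (monomial-+ y (+ 1) (+ n) z))

offset-copies : ∀ y n → offset (map (λ l → (+ 1 , l)) (replicate n (pos y))) ≡ + 0
offset-copies y zero    = refl
offset-copies y (suc n) = offset-copies y n

syntacticallyImplies-copies : ∀ D {D′} y n → IsNormalized D′ →
  (∀ z → coeff (terms D) z + monomial y (+ n) z ≡ coeff (terms D′) z) → rhs D ≡ rhs D′ →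
  SyntacticallyImplies D D′
syntacticallyImplies-copies D y n D′-normal coeffs-agree rhs-agree =
  replicate n (pos y) , normalize-≡-normalized (pb (terms D ++ copies) (deg D)) D′-normal λ where
    .coeff-≡ z → trans (coeff-++ (terms D) copies z)
                       (trans (cong (_+_ (coeff (terms D) z)) (coeff-copies y n z)) (coeffs-agree z))
    .rhs-≡ → trans (cong (_-_ (deg D)) offset-with-copies) rhs-agree
  where
  copies = map (λ l → (+ 1 , l)) (replicate n (pos y))
  offset-with-copies : offset (terms D ++ copies) ≡ offset (terms D)
  offset-with-copies = trans (offset-++ (terms D) copies)
                             (trans (cong (_+_ (offset (terms D))) (offset-copies y n)) (ℤP.+-identityʳ _))

Discharged : PBFormula → PB → PB → Set
Discharged G D E = E ∈ G ⊎ SyntacticallyImplies (negPB D) E ⊎ RUP (negPB D ∷ G) E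

module Reification (ts : List (ℤ × Lit)) (A : ℤ) (y : ℕ)
                   (ts≥0 : NonNegCoeffs ts) (y∉ts : coeff ts y ≡ + 0) where

  open ≡-Reasoning

  C : PB
  C = pb ts A

  B : ℤ
  B = - A + + 1 + sumCoeffs ts

  ts̄ : List (ℤ × Lit)
  ts̄ = map flip ts

  ts̄≥0 : NonNegCoeffs ts̄
  ts̄≥0 = map⁺ ts≥0

  y∉ts̄ : coeff ts̄ y ≡ + 0
  y∉ts̄ = trans (coeff-flip ts y) (cong -_ y∉ts)

  C₁-≈ : C₁ y C ≈ pb ((A , neg y) ∷ ts) A
  C₁-≈ = normalize-≈ _

  C₂-≈ : C₂ y C ≈ pb ((B , pos y) ∷ ts̄) B
  C₂-≈ = normalize-≈ _

  coeff-C₁-≢ : ∀ z → y ≢ z → coeff (terms (C₁ y C)) z ≡ coeff ts z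
  coeff-C₁-≢ z y≢z = trans (C₁-≈ .coeff-≡ z) (coeff-∷-≢ (A , neg y) ts y≢z)

  coeff-C₂-≢ : ∀ z → y ≢ z → coeff (terms (C₂ y C)) z ≡ coeff ts̄ z
  coeff-C₂-≢ z y≢z = trans (C₂-≈ .coeff-≡ z) (coeff-∷-≢ (B , pos y) ts̄ y≢z)

  coeff-C₁-y : coeff (terms (C₁ y C)) y ≡ - A
  coeff-C₁-y = begin
    coeff (terms (C₁ y C)) y          ≡⟨ C₁-≈ .coeff-≡ y ⟩
    monomial y (- A) y + coeff ts y   ≡⟨ cong₂ _+_ (monomial-≡ y (- A)) y∉ts ⟩
    - A + + 0                         ≡⟨ ℤP.+-identityʳ (- A) ⟩
    - A                               ∎

  coeff-C₂-y : coeff (terms (C₂ y C)) y ≡ B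
  coeff-C₂-y = begin
    coeff (terms (C₂ y C)) y      ≡⟨ C₂-≈ .coeff-≡ y ⟩
    monomial y B y + coeff ts̄ y   ≡⟨ cong₂ _+_ (monomial-≡ y B) y∉ts̄ ⟩
    B + + 0                       ≡⟨ ℤP.+-identityʳ B ⟩
    B                             ∎

  restrict-C₁-false : restrict (y ↦ false) (C₁ y C) ≈ pb ts (+ 0)
  restrict-C₁-false = restrict-≈ y false (C₁ y C) y∉ts coeff-C₁-≢ (begin
    rhs (C₁ y C) - + 0       ≡⟨ cong (_- + 0) (C₁-≈ .rhs-≡) ⟩
    (A - (A + offset ts)) - + 0  ≡⟨ cancel A (offset ts) ⟩
    + 0 - offset ts          ∎)
    where
    cancel : ∀ A k → (A - (A + k)) - + 0 ≡ + 0 - k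
    cancel = solve-∀

  restrict-C₁-true : restrict (y ↦ true) (C₁ y C) ≈ C
  restrict-C₁-true = restrict-≈ y true (C₁ y C) y∉ts coeff-C₁-≢ (begin
    rhs (C₁ y C) - coeff (terms (C₁ y C)) y  ≡⟨ cong₂ _-_ (C₁-≈ .rhs-≡) coeff-C₁-y ⟩
    (A - (A + offset ts)) - (- A)            ≡⟨ cancel A (offset ts) ⟩
    A - offset ts                            ∎)
    where
    cancel : ∀ A k → (A - (A + k)) - (- A) ≡ A - k
    cancel = solve-∀

  restrict-C₂-true : restrict (y ↦ true) (C₂ y C) ≈ pb ts̄ (+ 0)
  restrict-C₂-true = restrict-≈ y true (C₂ y C) y∉ts̄ coeff-C₂-≢ (begin
    rhs (C₂ y C) - coeff (terms (C₂ y C)) y  ≡⟨ cong₂ _-_ (C₂-≈ .rhs-≡) coeff-C₂-y ⟩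
    (B - offset ts̄) - B                      ≡⟨ cancel B (offset ts̄) ⟩
    + 0 - offset ts̄                          ∎)
    where
    cancel : ∀ B k → (B - k) - B ≡ + 0 - k
    cancel = solve-∀

  C₂-≈-negative : ∀ n → B ≡ -[1+ n ] → C₂ y C ≈ pb ((+ suc n , neg y) ∷ ts̄) (+ 0)
  C₂-≈-negative n B≡ = ≈-trans C₂-≈ λ where
      .coeff-≡ z → cong (λ b → monomial y b z + coeff ts̄ z) B≡
      .rhs-≡ → trans (cong (_- offset ts̄) B≡) (regroup (+ suc n) (offset ts̄))
    where
    regroup : ∀ b k → - b - k ≡ + 0 - (b + k)
    regroup = solve-∀

  negC₂-syntacticallyImplies-C : ∀ n → B ≡ + n → SyntacticallyImplies (negPB (C₂ y C)) (restrict (y ↦ true) (C₁ y C))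
  negC₂-syntacticallyImplies-C n B≡ = syntacticallyImplies-copies (negPB (C₂ y C)) y n (restrict-normalized (y ↦ true) (C₁ y C))
    (λ z → begin
      coeff (terms (negPB (C₂ y C))) z + monomial y (+ n) z       ≡⟨ cong₂ _+_ (coeff-negPB (C₂ y C) z) (cong (λ b → monomial y b z) (sym B≡)) ⟩
      - coeff (terms (C₂ y C)) z + monomial y B z                 ≡⟨ cong (λ c → - c + monomial y B z) (C₂-≈ .coeff-≡ z) ⟩
      - (monomial y B z + coeff ts̄ z) + monomial y B z            ≡⟨ cong (λ c → - (monomial y B z + c) + monomial y B z) (coeff-flip ts z) ⟩
      - (monomial y B z + - coeff ts z) + monomial y B z          ≡⟨ cancel (monomial y B z) (coeff ts z) ⟩
      coeff ts z                                                  ≡⟨ restrict-C₁-true .coeff-≡ z ⟨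
      coeff (terms (restrict (y ↦ true) (C₁ y C))) z              ∎)
    (begin
      rhs (negPB (C₂ y C))                          ≡⟨ rhs-negPB (C₂ y C) ⟩
      - rhs (C₂ y C) + + 1                          ≡⟨ cong (λ r → - r + + 1) (C₂-≈ .rhs-≡) ⟩
      - (B - offset ts̄) + + 1                       ≡⟨ cong (λ k → - (B - k) + + 1) (offset-flip ts) ⟩
      - (B - (sumCoeffs ts - offset ts)) + + 1      ≡⟨ regroup A (sumCoeffs ts) (offset ts) ⟩
      A - offset ts                                 ≡⟨ restrict-C₁-true .rhs-≡ ⟨
      rhs (restrict (y ↦ true) (C₁ y C))            ∎)
    where
    cancel : ∀ m c → - (m + - c) + m ≡ c
    cancel = solve-∀
    regroup : ∀ A s k → - ((- A + + 1 + s) - (s - k)) + + 1 ≡ A - k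
    regroup = solve-∀

  C₁-accepted : ∀ F → All IsNormalized F → All (λ D → ¬ OccursIn y D) F →
                RedundancyCheckAccepts F (C₁ y C) (y ↦ false)
  C₁-accepted F F-normal y∉F = inj₂
    ( inj₂ (inj₂ (RUP-trivial _ restrict-C₁-false ts≥0 ℤP.≤-refl))
    ∷ All.map inj₁ (restrict-fresh-⊆ F id F-normal y∉F))

  C₂-accepted : ∀ F → All IsNormalized F → All (λ D → ¬ OccursIn y D) F →
                RedundancyCheckAccepts (C₁ y C ∷ F) (C₂ y C) (y ↦ true)
  C₂-accepted F F-normal y∉F = inj₂
    ( inj₂ (inj₂ (RUP-trivial _ restrict-C₂-true ts̄≥0 ℤP.≤-refl))
    ∷ C₁-discharged
    ∷ All.map inj₁ (restrict-fresh-⊆ F there F-normal y∉F))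
    where
    C₁-discharged : Discharged (C₁ y C ∷ F) (C₂ y C) (restrict (y ↦ true) (C₁ y C))
    C₁-discharged = by-sign B refl
      where
      by-sign : ∀ b → B ≡ b → Discharged (C₁ y C ∷ F) (C₂ y C) (restrict (y ↦ true) (C₁ y C))
      by-sign (+ n)    B≡ = inj₂ (inj₁ (negC₂-syntacticallyImplies-C n B≡))
      by-sign -[1+ n ] B≡ = inj₂ (inj₂ (conflict (there (here refl))
                              (negPB-violated (C₂-≈-negative n B≡) (+≤+ ℕ.z≤n ∷ ts̄≥0) ℤP.≤-refl)))

proposition2 : (F : PBFormula) (C : PB) (y : ℕ) →
    All IsNormalized F → IsNormalized C →
    All (λ D → ¬ OccursIn y D) F → ¬ OccursIn y C →
    Σ Subst (λ ω₁ → RedundancyCheckAccepts F (C₁ y C) ω₁) ×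
    Σ Subst (λ ω₂ → RedundancyCheckAccepts (C₁ y C ∷ F) (C₂ y C) ω₂)
proposition2 F (pb ts A) y F-normal C-normal y∉F y∉C =
  (y ↦ false , C₁-accepted F F-normal y∉F) , (y ↦ true , C₂-accepted F F-normal y∉F)
  where
  open Reification ts A y (normalized-nonneg C-normal) (coeff-fresh ts (¬Any⇒All¬ ts y∉C))
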